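{- For all positive integers $N$ and $k$, $$\sum_{N\ge n_k\ge\cdots\ge n_1\ge1}\frac{(q)_{n_1}q^{n_1+n_2+\cdots+n_k}}{(1-q^{n_1})^2(1-q^{n_2})^2\cdots(1-q^{n_k})^2}=\sum_{N\ge n_k\ge\cdots\ge n_1\ge1}\frac{q^{n_1+n_2+\cdots+n_k}}{(1-q^{n_1})^2\cdots(1-q^{n_k})^2}+(q)_N^2\sum_{r=1}^{N}\frac{(-1)^rq^{\frac{r(3r-1)}{2}+kr}(1+q^r)}{(q)_{N-r}(q)_{N+r}(1-q^r)^{2k}}.$$
   Context: $(a)_n=(a;q)_n=\prod_{i=0}^{n-1}(1-aq^i)$, $(a)_0=1$. -}

module Defs where

open import Data.Nat as ℕ using (ℕ; zero; suc)
open import Data.Rational using (ℚ; 0ℚ; 1ℚ; _+_; _*_; _-_; -_; 1/_; ≢-nonZero)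
open import Data.Rational.Properties using (_≟_)
open import Relation.Nullary using (yes; no)

_^_ : ℚ → ℕ → ℚ
q ^ zero  = 1ℚ
q ^ suc n = (q ^ n) * q

infixr 8 _^_

-- total inverse (inv 0 = 0); only ever applied to nonzero denominators
inv : ℚ → ℚ
inv p with p ≟ 0ℚ
... | yes _  = 0ℚ
... | no p≢0 = 1/_ p {{≢-nonZero p≢0}}

_÷_ : ℚ → ℚ → ℚ
a ÷ b = a * inv b

infixl 7 _÷_

poch : ℚ → ℚ → ℕ → ℚ
poch a q zero    = 1ℚ
poch a q (suc n) = poch a q n * (1ℚ - a * q ^ n)

qp : ℚ → ℕ → ℚ
qp q n = poch q q n

sum1 : ℕ → (ℕ → ℚ) → ℚ
sum1 zero    f = 0ℚ
sum1 (suc u) f = sum1 u f + f (suc u)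

w : ℚ → ℕ → ℚ
w q n = (q ^ n) ÷ ((1ℚ - q ^ n) * (1ℚ - q ^ n))

-- chain q g k u  (k ≥ 1) =
--   Σ_{u ≥ n_k ≥ ... ≥ n_1 ≥ 1}  g(n_1) · ∏_{i=1}^{k} q^{n_i}/(1-q^{n_i})^2
chain : ℚ → (ℕ → ℚ) → ℕ → ℕ → ℚ
chain q g zero    m = g m
chain q g (suc k) u = sum1 u (λ n → w q n * chain q g k n)

pent : ℕ → ℕ
pent r = (r ℕ.* (3 ℕ.* r ℕ.∸ 1)) ℕ./ 2

-- Multiply the right-hand sum by (q)_N² and call its r-th summand
-- T_k(N,r) = (-1)^r q^{r(3r-1)/2} (1+q^r) w(r)^k (q)_N² / ((q)_{N-r} (q)_{N+r}),
-- where w(n) = q^n/(1-q^n)².  Then Σ_r T_k(N,r), like chain with g(n) = (q)_n - 1,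
-- satisfies C_{k+1}(N+1) = C_{k+1}(N) + w(N+1) C_k(N+1): passing from N to N+1
-- multiplies T_k(N,r) by a factor ρ with w(r) ρ = w(r) + w(N+1) ρ, a partial fraction
-- identity.  At k = 0 both sides agree by the finite pentagonal identity
-- (q)_N - 1 = Σ_r T_0(N,r), proved by telescoping with an explicit certificate.
-- Since chain is additive in g, splitting (q)_n = 1 + ((q)_n - 1) gives the theorem.
module Submission where

open import Data.Empty using (⊥-elim)
open import Data.Nat as ℕ using (ℕ; zero; suc; pred; _≤_; _<_; _∸_; z≤n; s≤s)
import Data.Nat.Properties as ℕₚ
open import Data.Nat.Divisibility using (n∣m*n)
open import Data.Nat.DivMod using (m*n/n≡m; +-distrib-/-∣ʳ)
import Data.Nat.Tactic.RingSolver as ℕ-Solver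
open import Data.List using (_∷_; [])
open import Data.Rational using (ℚ; 0ℚ; 1ℚ; _+_; _*_; _-_; -_; ≢-nonZero)
open import Data.Rational.Properties
  using (_≟_; +-*-commutativeRing; 1≢0; *-inverseˡ; *-assoc; *-comm; *-identityˡ; *-identityʳ;
         *-zeroˡ; *-zeroʳ; *-distribˡ-+; +-inverseʳ)
open import Level using (0ℓ)
open import Relation.Binary.PropositionalEquality
open import Relation.Nullary using (Dec; yes; no)
open import Relation.Nullary.Decidable using (dec⇒maybe)
open import Tactic.RingSolver using (solve-∀; solve)
import Tactic.RingSolver.Core.AlmostCommutativeRing as ACR
open import Defs

open ≡-Reasoning

-- The zero test lets the normaliser drop cancelled monomials.
ℚ-ring : ACR.AlmostCommutativeRing 0ℓ 0ℓ
ℚ-ring = ACR.fromCommutativeRing +-*-commutativeRing (λ x → dec⇒maybe (0ℚ ≟ x))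

^-distribˡ-+-* : ∀ x m n → x ^ (m ℕ.+ n) ≡ x ^ m * x ^ n
^-distribˡ-+-* x m zero = trans (cong (x ^_) (ℕₚ.+-identityʳ m)) (sym (*-identityʳ (x ^ m)))
^-distribˡ-+-* x m (suc n) = begin
  x ^ (m ℕ.+ suc n)  ≡⟨ cong (x ^_) (ℕₚ.+-suc m n) ⟩
  x ^ (m ℕ.+ n) * x  ≡⟨ cong (_* x) (^-distribˡ-+-* x m n) ⟩
  x ^ m * x ^ n * x  ≡⟨ *-assoc (x ^ m) (x ^ n) x ⟩
  x ^ m * (x ^ n * x) ∎

^-distribʳ-* : ∀ x y n → (x * y) ^ n ≡ x ^ n * y ^ n
^-distribʳ-* x y zero = refl
^-distribʳ-* x y (suc n) = begin
  (x * y) ^ n * (x * y)      ≡⟨ cong (_* (x * y)) (^-distribʳ-* x y n) ⟩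
  x ^ n * y ^ n * (x * y)    ≡⟨ interchange (x ^ n) (y ^ n) x y ⟩
  x ^ n * x * (y ^ n * y)    ∎
  where
  interchange : ∀ a b c d → a * b * (c * d) ≡ a * c * (b * d)
  interchange = solve-∀ ℚ-ring

^-*-assoc : ∀ x m n → (x ^ m) ^ n ≡ x ^ (m ℕ.* n)
^-*-assoc x m zero = cong (x ^_) (sym (ℕₚ.*-zeroʳ m))
^-*-assoc x m (suc n) = begin
  (x ^ m) ^ n * x ^ m       ≡⟨ cong (_* x ^ m) (^-*-assoc x m n) ⟩
  x ^ (m ℕ.* n) * x ^ m     ≡⟨ sym (^-distribˡ-+-* x (m ℕ.* n) m) ⟩
  x ^ (m ℕ.* n ℕ.+ m)       ≡⟨ cong (x ^_) (trans (ℕₚ.+-comm (m ℕ.* n) m) (sym (ℕₚ.*-suc m n))) ⟩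
  x ^ (m ℕ.* suc n)         ∎

inv-inverseˡ : ∀ {p} → p ≢ 0ℚ → inv p * p ≡ 1ℚ
inv-inverseˡ {p} p≢0 with p ≟ 0ℚ
... | yes p≡0 = ⊥-elim (p≢0 p≡0)
... | no p≢0′ = *-inverseˡ p {{≢-nonZero p≢0′}}

*-≢0 : ∀ {p r} → p ≢ 0ℚ → r ≢ 0ℚ → p * r ≢ 0ℚ
*-≢0 {p} {r} p≢0 r≢0 pr≡0 = r≢0 (begin
  r                ≡⟨ sym (*-identityˡ r) ⟩
  1ℚ * r           ≡⟨ cong (_* r) (sym (inv-inverseˡ p≢0)) ⟩
  inv p * p * r    ≡⟨ *-assoc (inv p) p r ⟩
  inv p * (p * r)  ≡⟨ cong (inv p *_) pr≡0 ⟩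
  inv p * 0ℚ       ≡⟨ *-zeroʳ (inv p) ⟩
  0ℚ               ∎)

inv-0 : ∀ {p} → p ≡ 0ℚ → inv p ≡ 0ℚ
inv-0 refl = refl

inv-distrib-* : ∀ p r → inv (p * r) ≡ inv p * inv r
inv-distrib-* p r = cases (p ≟ 0ℚ) (r ≟ 0ℚ)
  where
  cases : Dec (p ≡ 0ℚ) → Dec (r ≡ 0ℚ) → inv (p * r) ≡ inv p * inv r
  cases (yes p≡0) _ = trans (inv-0 (trans (cong (_* r) p≡0) (*-zeroˡ r)))
                            (sym (trans (cong (_* inv r) (inv-0 p≡0)) (*-zeroˡ (inv r))))
  cases (no _) (yes r≡0) = trans (inv-0 (trans (cong (p *_) r≡0) (*-zeroʳ p)))
                                 (sym (trans (cong (inv p *_) (inv-0 r≡0)) (*-zeroʳ (inv p))))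
  cases (no p≢0) (no r≢0) = begin
    inv (p * r)
      ≡⟨ insert-units (inv (p * r)) ⟩
    inv (p * r) * 1ℚ * 1ℚ
      ≡⟨ cong₂ (λ u v → inv (p * r) * u * v) (sym (inv-inverseˡ p≢0)) (sym (inv-inverseˡ r≢0)) ⟩
    inv (p * r) * (inv p * p) * (inv r * r)
      ≡⟨ regroup (inv (p * r)) p r (inv p) (inv r) ⟩
    inv (p * r) * (p * r) * (inv p * inv r)
      ≡⟨ cong (_* (inv p * inv r)) (inv-inverseˡ (*-≢0 p≢0 r≢0)) ⟩
    1ℚ * (inv p * inv r)
      ≡⟨ *-identityˡ (inv p * inv r) ⟩
    inv p * inv r ∎
    where
    insert-units : ∀ a → a ≡ a * 1ℚ * 1ℚ
    insert-units = solve-∀ ℚ-ring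
    regroup : ∀ i p r ip ir → i * (ip * p) * (ir * r) ≡ i * (p * r) * (ip * ir)
    regroup = solve-∀ ℚ-ring

inv-^ : ∀ x n → inv (x ^ n) ≡ inv x ^ n
inv-^ x zero = refl
inv-^ x (suc n) = trans (inv-distrib-* (x ^ n) x) (cong (_* inv x) (inv-^ x n))

ω : ℚ → ℚ
ω x = x ÷ ((1ℚ - x) * (1ℚ - x))

ω-^ : ∀ x k → x ^ k * inv ((1ℚ - x) ^ (2 ℕ.* k)) ≡ ω x ^ k
ω-^ x k = begin
  x ^ k * inv (D ^ (2 ℕ.* k))  ≡⟨ cong (λ e → x ^ k * inv e) (sym (^-*-assoc D 2 k)) ⟩
  x ^ k * inv ((D ^ 2) ^ k)    ≡⟨ cong (x ^ k *_) (inv-^ (D ^ 2) k) ⟩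
  x ^ k * inv (D ^ 2) ^ k      ≡⟨ cong (λ e → x ^ k * inv (e * D) ^ k) (*-identityˡ D) ⟩
  x ^ k * inv (D * D) ^ k      ≡⟨ sym (^-distribʳ-* x (inv (D * D)) k) ⟩
  ω x ^ k                      ∎
  where
  D = 1ℚ - x

sum1-cong : ∀ n {f g : ℕ → ℚ} → (∀ r → 1 ≤ r → r ≤ n → f r ≡ g r) → sum1 n f ≡ sum1 n g
sum1-cong zero _ = refl
sum1-cong (suc n) f≡g =
  cong₂ _+_ (sum1-cong n (λ r 1≤r r≤n → f≡g r 1≤r (ℕₚ.m≤n⇒m≤1+n r≤n)))
            (f≡g (suc n) (s≤s z≤n) ℕₚ.≤-refl)

sum1-+ : ∀ n (f g : ℕ → ℚ) → sum1 n (λ r → f r + g r) ≡ sum1 n f + sum1 n g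
sum1-+ zero f g = refl
sum1-+ (suc n) f g = trans (cong (_+ (f (suc n) + g (suc n))) (sum1-+ n f g))
                           (interchange (sum1 n f) (sum1 n g) (f (suc n)) (g (suc n)))
  where
  interchange : ∀ a b c d → a + b + (c + d) ≡ a + c + (b + d)
  interchange = solve-∀ ℚ-ring

sum1-*ˡ : ∀ n c (f : ℕ → ℚ) → sum1 n (λ r → c * f r) ≡ c * sum1 n f
sum1-*ˡ zero c f = sym (*-zeroʳ c)
sum1-*ˡ (suc n) c f = trans (cong (_+ c * f (suc n)) (sum1-*ˡ n c f))
                            (sym (*-distribˡ-+ c (sum1 n f) (f (suc n))))

sum1-telescope : ∀ n (G : ℕ → ℚ) → sum1 n (λ r → G r - G (pred r)) ≡ G n - G 0
sum1-telescope zero G = sym (+-inverseʳ (G 0))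
sum1-telescope (suc n) G = trans (cong (_+ (G (suc n) - G n)) (sum1-telescope n G))
                                 (cancel (G 0) (G n) (G (suc n)))
  where
  cancel : ∀ a b c → b - a + (c - b) ≡ c - a
  cancel = solve-∀ ℚ-ring

-- chain as the solution of its recursion

chain-+ : ∀ q {g g₁ g₂ : ℕ → ℚ} → (∀ n → g n ≡ g₁ n + g₂ n) →
          ∀ k u → chain q g k u ≡ chain q g₁ k u + chain q g₂ k u
chain-+ q g≡ zero u = g≡ u
chain-+ q {g} {g₁} {g₂} g≡ (suc k) u = begin
  sum1 u (λ n → w q n * chain q g k n)
    ≡⟨ sum1-cong u (λ n _ _ → trans (cong (w q n *_) (chain-+ q g≡ k n))
                                     (*-distribˡ-+ (w q n) (chain q g₁ k n) (chain q g₂ k n))) ⟩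
  sum1 u (λ n → w q n * chain q g₁ k n + w q n * chain q g₂ k n)
    ≡⟨ sum1-+ u _ _ ⟩
  chain q g₁ (suc k) u + chain q g₂ (suc k) u ∎

chain-unique : ∀ q g (F : ℕ → ℕ → ℚ) B →
               (∀ N → N ≤ B → F 0 N ≡ g N) →
               (∀ k → F (suc k) 0 ≡ 0ℚ) →
               (∀ k N → suc N ≤ B →
                  F (suc k) (suc N) ≡ F (suc k) N + w q (suc N) * F k (suc N)) →
               ∀ k N → N ≤ B → chain q g k N ≡ F k N
chain-unique q g F B base empty step zero N N≤B = sym (base N N≤B)
chain-unique q g F B base empty step (suc k) zero _ = sym (empty k)
chain-unique q g F B base empty step (suc k) (suc N) N<B = begin
  chain q g (suc k) N + w q (suc N) * chain q g k (suc N)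
    ≡⟨ cong₂ (λ u v → u + w q (suc N) * v)
             (solution (suc k) N (ℕₚ.<⇒≤ N<B)) (solution k (suc N) N<B) ⟩
  F (suc k) N + w q (suc N) * F k (suc N)
    ≡⟨ sym (step k N N<B) ⟩
  F (suc k) (suc N) ∎
  where
  solution = chain-unique q g F B base empty step

-- The factor by which pochRatio N r grows from N to N + 1, where a = q^{N+1-r} and x = q^r.
growth : ℚ → ℚ → ℚ
growth a x = (1ℚ - a * x) * (1ℚ - a * x) * (inv (1ℚ - a) * inv (1ℚ - a * x * x))

partial-fractions : ∀ {a x} → 1ℚ - a ≢ 0ℚ → 1ℚ - x ≢ 0ℚ → 1ℚ - a * x ≢ 0ℚ →
                    1ℚ - a * x * x ≢ 0ℚ → ω x * growth a x ≡ ω x + ω (a * x) * growth a x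
partial-fractions {a} {x} a≢1 x≢1 ax≢1 axx≢1 = begin
  x * inv ((1ℚ - x) * (1ℚ - x)) * growth a x
    ≡⟨ cong (λ u → x * u * growth a x) (inv-distrib-* (1ℚ - x) (1ℚ - x)) ⟩
  x * (ix * ix) * ((1ℚ - a * x) * (1ℚ - a * x) * (ia * ic))
    ≡⟨ core a x ia ix iy ic (inv-inverseˡ a≢1) (inv-inverseˡ x≢1)
                            (inv-inverseˡ ax≢1) (inv-inverseˡ axx≢1) ⟩
  x * (ix * ix) + a * x * (iy * iy) * growth a x
    ≡⟨ cong₂ (λ u v → x * u + a * x * v * growth a x)
             (sym (inv-distrib-* (1ℚ - x) (1ℚ - x)))
             (sym (inv-distrib-* (1ℚ - a * x) (1ℚ - a * x))) ⟩
  ω x + ω (a * x) * growth a x ∎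
  where
  ia = inv (1ℚ - a)
  ix = inv (1ℚ - x)
  iy = inv (1ℚ - a * x)
  ic = inv (1ℚ - a * x * x)
  -- x (1 - a x)² = x (1 - a) (1 - a x²) + a x (1 - x)²
  core : ∀ a x ia ix iy ic → ia * (1ℚ - a) ≡ 1ℚ → ix * (1ℚ - x) ≡ 1ℚ →
         iy * (1ℚ - a * x) ≡ 1ℚ → ic * (1ℚ - a * x * x) ≡ 1ℚ →
         x * (ix * ix) * ((1ℚ - a * x) * (1ℚ - a * x) * (ia * ic))
           ≡ x * (ix * ix) + a * x * (iy * iy) * ((1ℚ - a * x) * (1ℚ - a * x) * (ia * ic))
  core a x ia ix iy ic ha hx hy hc = begin
    x * (ix * ix) * ((1ℚ - a * x) * (1ℚ - a * x) * (ia * ic))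
      ≡⟨ solve (a ∷ x ∷ ia ∷ ix ∷ iy ∷ ic ∷ []) ℚ-ring ⟩
    x * (ix * ix) * ((ia * (1ℚ - a)) * (ic * (1ℚ - a * x * x)))
      + a * x * (ia * ic) * ((ix * (1ℚ - x)) * (ix * (1ℚ - x)))
      ≡⟨ cong₂ (λ u v → x * (ix * ix) * u + a * x * (ia * ic) * (v * v)) (cong₂ _*_ ha hc) hx ⟩
    x * (ix * ix) * (1ℚ * 1ℚ) + a * x * (ia * ic) * (1ℚ * 1ℚ)
      ≡⟨ cong (λ v → x * (ix * ix) * (1ℚ * 1ℚ) + a * x * (ia * ic) * (v * v)) (sym hy) ⟩
    x * (ix * ix) * (1ℚ * 1ℚ)
      + a * x * (ia * ic) * ((iy * (1ℚ - a * x)) * (iy * (1ℚ - a * x)))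
      ≡⟨ solve (a ∷ x ∷ ia ∷ ix ∷ iy ∷ ic ∷ []) ℚ-ring ⟩
    x * (ix * ix) + a * x * (iy * iy) * ((1ℚ - a * x) * (1ℚ - a * x) * (ia * ic)) ∎

-- (1 + x)(1 - a x) = (1 + x)(1 - a)(1 - a x²) + a x³ (1 - a) + a (1 - a x²)
pentagonal-core : ∀ Z x a P A B ia ic → ia * (1ℚ - a) ≡ 1ℚ → ic * (1ℚ - a * x * x) ≡ 1ℚ →
                  Z * (1ℚ + x) * 1ℚ * (P * P * (A * B)) * ((1ℚ - a * x) * (1ℚ - a * x) * (ia * ic))
                    ≡ (1ℚ - a * x) * (Z * (1ℚ + x) * 1ℚ * (P * P * (A * B)))
                      + (Z * (a * x * x * x) * (P * (1ℚ - a * x) * P * (A * (B * ic)))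
                         - - (Z * a) * (P * (1ℚ - a * x) * P * (A * ia * B)))
pentagonal-core Z x a P A B ia ic ha hc = begin
  Z * (1ℚ + x) * 1ℚ * (P * P * (A * B)) * ((1ℚ - a * x) * (1ℚ - a * x) * (ia * ic))
    ≡⟨ solve (Z ∷ x ∷ a ∷ P ∷ A ∷ B ∷ ia ∷ ic ∷ []) ℚ-ring ⟩
  Z * P * P * A * B * (1ℚ - a * x)
    * ((1ℚ + x) * (ia * (1ℚ - a)) * (ic * (1ℚ - a * x * x))
       + a * x * x * x * ic * (ia * (1ℚ - a)) + a * ia * (ic * (1ℚ - a * x * x)))
    ≡⟨ cong₂ (λ u v → Z * P * P * A * B * (1ℚ - a * x)
                        * ((1ℚ + x) * u * v + a * x * x * x * ic * u + a * ia * v)) ha hc ⟩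
  Z * P * P * A * B * (1ℚ - a * x) * ((1ℚ + x) * 1ℚ * 1ℚ + a * x * x * x * ic * 1ℚ + a * ia * 1ℚ)
    ≡⟨ solve (Z ∷ x ∷ a ∷ P ∷ A ∷ B ∷ ia ∷ ic ∷ []) ℚ-ring ⟩
  (1ℚ - a * x) * (Z * (1ℚ + x) * 1ℚ * (P * P * (A * B)))
    + (Z * (a * x * x * x) * (P * (1ℚ - a * x) * P * (A * (B * ic)))
       - - (Z * a) * (P * (1ℚ - a * x) * P * (A * ia * B))) ∎

pent-suc : ∀ m → pent (suc m) ≡ pent m ℕ.+ suc (3 ℕ.* m)
pent-suc zero = refl
pent-suc (suc m) = begin
  suc (suc m) ℕ.* (3 ℕ.* suc (suc m) ∸ 1) ℕ./ 2
    ≡⟨ cong (λ t → suc (suc m) ℕ.* t ℕ./ 2) (3*suc∸1 (suc m)) ⟩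
  suc (suc m) ℕ.* (3 ℕ.* suc m ℕ.+ 2) ℕ./ 2
    ≡⟨ cong (ℕ._/ 2) (expand m) ⟩
  (suc m ℕ.* (3 ℕ.* m ℕ.+ 2) ℕ.+ suc (3 ℕ.* suc m) ℕ.* 2) ℕ./ 2
    ≡⟨ +-distrib-/-∣ʳ (suc m ℕ.* (3 ℕ.* m ℕ.+ 2)) (n∣m*n (suc (3 ℕ.* suc m))) ⟩
  suc m ℕ.* (3 ℕ.* m ℕ.+ 2) ℕ./ 2 ℕ.+ suc (3 ℕ.* suc m) ℕ.* 2 ℕ./ 2
    ≡⟨ cong₂ ℕ._+_ (cong (λ t → suc m ℕ.* t ℕ./ 2) (sym (3*suc∸1 m)))
                   (m*n/n≡m (suc (3 ℕ.* suc m)) 2) ⟩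
  pent (suc m) ℕ.+ suc (3 ℕ.* suc m) ∎
  where
  3*suc∸1 : ∀ m → 3 ℕ.* suc m ∸ 1 ≡ 3 ℕ.* m ℕ.+ 2
  3*suc∸1 m = cong (_∸ 1) (3*suc m)
    where
    3*suc : ∀ m → 3 ℕ.* suc m ≡ suc (3 ℕ.* m ℕ.+ 2)
    3*suc = ℕ-Solver.solve-∀
  expand : ∀ m → suc (suc m) ℕ.* (3 ℕ.* suc m ℕ.+ 2)
                   ≡ suc m ℕ.* (3 ℕ.* m ℕ.+ 2) ℕ.+ suc (3 ℕ.* suc m) ℕ.* 2
  expand = ℕ-Solver.solve-∀

module _ (q : ℚ) where

  FactorsNonZero : ℕ → Set
  FactorsNonZero B = ∀ i → 1 ≤ i → i ≤ B → 1ℚ - q ^ i ≢ 0ℚ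

  FactorsNonZero-mono : ∀ {B B′} → B′ ≤ B → FactorsNonZero B → FactorsNonZero B′
  FactorsNonZero-mono B′≤B nz i 1≤i i≤B′ = nz i 1≤i (ℕₚ.≤-trans i≤B′ B′≤B)

  1-q^suc≢0 : ∀ {B m} → FactorsNonZero B → suc m ≤ B → 1ℚ - q ^ suc m ≢ 0ℚ
  1-q^suc≢0 nz = nz _ (s≤s z≤n)

  iqp : ℕ → ℚ
  iqp n = inv (qp q n)

  qp-suc : ∀ n → qp q (suc n) ≡ qp q n * (1ℚ - q ^ suc n)
  qp-suc n = cong (λ y → qp q n * (1ℚ - y)) (*-comm q (q ^ n))

  iqp-suc : ∀ n → iqp (suc n) ≡ iqp n * inv (1ℚ - q ^ suc n)
  iqp-suc n = trans (cong inv (qp-suc n)) (inv-distrib-* (qp q n) (1ℚ - q ^ suc n))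

  qp≢0 : ∀ {B} → FactorsNonZero B → ∀ n → n ≤ B → qp q n ≢ 0ℚ
  qp≢0 nz zero _ = 1≢0
  qp≢0 nz (suc n) n<B =
    subst (_≢ 0ℚ) (sym (qp-suc n)) (*-≢0 (qp≢0 nz n (ℕₚ.<⇒≤ n<B)) (1-q^suc≢0 nz n<B))

  q^suc-split : ∀ {N r} → r ≤ N → q ^ suc N ≡ q ^ suc (N ∸ r) * q ^ r
  q^suc-split {N} {r} r≤N = begin
    q ^ suc N                 ≡⟨ cong (λ m → q ^ suc m) (sym (ℕₚ.m∸n+n≡m r≤N)) ⟩
    q ^ (suc (N ∸ r) ℕ.+ r)   ≡⟨ ^-distribˡ-+-* q (suc (N ∸ r)) r ⟩
    q ^ suc (N ∸ r) * q ^ r   ∎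

  q^suc+-split : ∀ {N r} → r ≤ N → q ^ suc (N ℕ.+ r) ≡ q ^ suc (N ∸ r) * q ^ r * q ^ r
  q^suc+-split {N} {r} r≤N = trans (^-distribˡ-+-* q (suc N) r) (cong (_* q ^ r) (q^suc-split r≤N))

  qp-suc-split : ∀ {N r} → r ≤ N → qp q (suc N) ≡ qp q N * (1ℚ - q ^ suc (N ∸ r) * q ^ r)
  qp-suc-split {N} r≤N = trans (qp-suc N) (cong (λ y → qp q N * (1ℚ - y)) (q^suc-split r≤N))

  iqp-∸-split : ∀ {n j} → j < n → iqp (n ∸ j) ≡ iqp (n ∸ suc j) * inv (1ℚ - q ^ suc (n ∸ suc j))
  iqp-∸-split {n} {j} j<n = trans (cong iqp (ℕₚ.+-∸-assoc 1 j<n)) (iqp-suc (n ∸ suc j))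

  iqp-+-split : ∀ {N r} → r ≤ N →
                iqp (suc (N ℕ.+ r)) ≡ iqp (N ℕ.+ r) * inv (1ℚ - q ^ suc (N ∸ r) * q ^ r * q ^ r)
  iqp-+-split {N} {r} r≤N =
    trans (iqp-suc (N ℕ.+ r)) (cong (λ y → iqp (N ℕ.+ r) * inv (1ℚ - y)) (q^suc+-split r≤N))

  pochRatio : ℕ → ℕ → ℚ
  pochRatio N r = qp q N * qp q N * (iqp (N ∸ r) * iqp (N ℕ.+ r))

  pochRatio-suc : ∀ {N r} → r ≤ N →
                  pochRatio (suc N) r ≡ pochRatio N r * growth (q ^ suc (N ∸ r)) (q ^ r)
  pochRatio-suc {N} {r} r≤N = begin
    qp q (suc N) * qp q (suc N) * (iqp (suc N ∸ r) * iqp (suc (N ℕ.+ r)))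
      ≡⟨ cong₂ (λ u v → u * u * v) (qp-suc-split r≤N)
               (cong₂ _*_ (iqp-∸-split (s≤s r≤N)) (iqp-+-split r≤N)) ⟩
    P * (1ℚ - a * x) * (P * (1ℚ - a * x)) * (A * inv (1ℚ - a) * (B * inv (1ℚ - a * x * x)))
      ≡⟨ regroup P (1ℚ - a * x) A (inv (1ℚ - a)) B (inv (1ℚ - a * x * x)) ⟩
    pochRatio N r * growth a x ∎
    where
    P = qp q N
    A = iqp (N ∸ r)
    B = iqp (N ℕ.+ r)
    a = q ^ suc (N ∸ r)
    x = q ^ r
    regroup : ∀ P c A ia B ic →
              P * c * (P * c) * (A * ia * (B * ic)) ≡ P * P * (A * B) * (c * c * (ia * ic))
    regroup = solve-∀ ℚ-ring

  pentagonal : ℕ → ℚ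
  pentagonal r = (- 1ℚ) ^ r * q ^ pent r

  pentagonal-one : pentagonal 1 ≡ - q
  pentagonal-one = sign q
    where
    sign : ∀ q → 1ℚ * - 1ℚ * (1ℚ * q) ≡ - q
    sign = solve-∀ ℚ-ring

  pentagonal-suc : ∀ m → pentagonal (suc m) ≡ - (pentagonal m * q ^ suc (3 ℕ.* m))
  pentagonal-suc m = begin
    (- 1ℚ) ^ m * - 1ℚ * q ^ pent (suc m)
      ≡⟨ cong (λ e → (- 1ℚ) ^ m * - 1ℚ * q ^ e) (pent-suc m) ⟩
    (- 1ℚ) ^ m * - 1ℚ * q ^ (pent m ℕ.+ suc (3 ℕ.* m))
      ≡⟨ cong ((- 1ℚ) ^ m * - 1ℚ *_) (^-distribˡ-+-* q (pent m) (suc (3 ℕ.* m))) ⟩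
    (- 1ℚ) ^ m * - 1ℚ * (q ^ pent m * q ^ suc (3 ℕ.* m))
      ≡⟨ flip-sign ((- 1ℚ) ^ m) (q ^ pent m) (q ^ suc (3 ℕ.* m)) ⟩
    - (pentagonal m * q ^ suc (3 ℕ.* m)) ∎
    where
    flip-sign : ∀ s p t → s * - 1ℚ * (p * t) ≡ - (s * p * t)
    flip-sign = solve-∀ ℚ-ring

  term : ℕ → ℕ → ℕ → ℚ
  term k N r = pentagonal r * (1ℚ + q ^ r) * w q r ^ k * pochRatio N r

  Σterm : ℕ → ℕ → ℚ
  Σterm k N = sum1 N (term k N)

  term-suc-k : ∀ k N r → term (suc k) N r ≡ w q r * term k N r
  term-suc-k k N r = shuffle (pentagonal r * (1ℚ + q ^ r)) (w q r ^ k) (w q r) (pochRatio N r)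
    where
    shuffle : ∀ a b c d → a * (b * c) * d ≡ c * (a * b * d)
    shuffle = solve-∀ ℚ-ring

  term-suc-N : ∀ k {N r} → r ≤ N →
               term k (suc N) r ≡ term k N r * growth (q ^ suc (N ∸ r)) (q ^ r)
  term-suc-N k {N} {r} r≤N =
    trans (cong (c *_) (pochRatio-suc r≤N)) (sym (*-assoc c (pochRatio N r) _))
    where
    c = pentagonal r * (1ℚ + q ^ r) * w q r ^ k

  term-step : ∀ k {N r} → FactorsNonZero (suc N ℕ.+ suc N) → 1 ≤ r → r ≤ N →
              term (suc k) (suc N) r ≡ term (suc k) N r + w q (suc N) * term k (suc N) r
  term-step k {N} {r} nz 1≤r r≤N = begin
    term (suc k) (suc N) r         ≡⟨ term-suc-k k (suc N) r ⟩
    ω x * term k (suc N) r         ≡⟨ cong (ω x *_) (term-suc-N k r≤N) ⟩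
    ω x * (t * g)                  ≡⟨ sym (*-assoc (ω x) t g) ⟩
    ω x * t * g                    ≡⟨ swap (ω x) t g ⟩
    ω x * g * t                    ≡⟨ cong (_* t) (partial-fractions {a} {x} a≢1 x≢1 ax≢1 axx≢1) ⟩
    (ω x + ω (a * x) * g) * t      ≡⟨ distrib (ω x) (ω (a * x)) g t ⟩
    ω x * t + ω (a * x) * (t * g)  ≡⟨ cong₂ _+_ (sym (term-suc-k k N r))
                                                (cong₂ _*_ (cong ω (sym (q^suc-split r≤N)))
                                                           (sym (term-suc-N k r≤N))) ⟩
    term (suc k) N r + w q (suc N) * term k (suc N) r ∎
    where
    t = term k N r
    a = q ^ suc (N ∸ r)
    x = q ^ r
    g = growth a x
    swap : ∀ u v y → u * v * y ≡ u * y * v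
    swap = solve-∀ ℚ-ring
    distrib : ∀ u v y z → (u + v * y) * z ≡ u * z + v * (z * y)
    distrib = solve-∀ ℚ-ring
    r≤2N+2 : r ≤ suc N ℕ.+ suc N
    r≤2N+2 = ℕₚ.≤-trans r≤N (ℕₚ.≤-trans (ℕₚ.n≤1+n N) (ℕₚ.m≤m+n (suc N) (suc N)))
    a≢1 : 1ℚ - a ≢ 0ℚ
    a≢1 = 1-q^suc≢0 nz (ℕₚ.≤-trans (s≤s (ℕₚ.m∸n≤m N r)) (ℕₚ.m≤m+n (suc N) (suc N)))
    x≢1 : 1ℚ - x ≢ 0ℚ
    x≢1 = nz r 1≤r r≤2N+2
    ax≢1 : 1ℚ - a * x ≢ 0ℚ
    ax≢1 = subst (λ y → 1ℚ - y ≢ 0ℚ) (q^suc-split r≤N)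
                 (1-q^suc≢0 nz (ℕₚ.m≤m+n (suc N) (suc N)))
    axx≢1 : 1ℚ - a * x * x ≢ 0ℚ
    axx≢1 = subst (λ y → 1ℚ - y ≢ 0ℚ) (q^suc+-split r≤N)
                  (1-q^suc≢0 nz (s≤s (ℕₚ.+-monoʳ-≤ N (ℕₚ.m≤n⇒m≤1+n r≤N))))

  Σterm-step : ∀ k N → FactorsNonZero (suc N ℕ.+ suc N) →
               Σterm (suc k) (suc N) ≡ Σterm (suc k) N + w q (suc N) * Σterm k (suc N)
  Σterm-step k N nz = begin
    sum1 N (term (suc k) (suc N)) + term (suc k) (suc N) (suc N)
      ≡⟨ cong₂ _+_ (sum1-cong N (λ r → term-step k nz)) (term-suc-k k (suc N) (suc N)) ⟩
    sum1 N (λ r → term (suc k) N r + W * term k (suc N) r) + W * term k (suc N) (suc N)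
      ≡⟨ cong (_+ W * term k (suc N) (suc N))
              (trans (sum1-+ N (term (suc k) N) (λ r → W * term k (suc N) r))
                     (cong (Σterm (suc k) N +_) (sum1-*ˡ N W (term k (suc N))))) ⟩
    Σterm (suc k) N + W * sum1 N (term k (suc N)) + W * term k (suc N) (suc N)
      ≡⟨ factor (Σterm (suc k) N) W (sum1 N (term k (suc N))) (term k (suc N) (suc N)) ⟩
    Σterm (suc k) N + W * Σterm k (suc N) ∎
    where
    W = w q (suc N)
    factor : ∀ s u y z → s + u * y + u * z ≡ s + u * (y + z)
    factor = solve-∀ ℚ-ring

  -- The finite pentagonal identity

  ^-3* : ∀ m → q ^ (3 ℕ.* m) ≡ q ^ m * q ^ m * q ^ m
  ^-3* m = begin
    q ^ (3 ℕ.* m)               ≡⟨ cong (q ^_) (ℕₚ.*-comm 3 m) ⟩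
    q ^ (m ℕ.* 3)               ≡⟨ sym (^-*-assoc q m 3) ⟩
    1ℚ * q ^ m * q ^ m * q ^ m  ≡⟨ cong (λ y → y * q ^ m * q ^ m) (*-identityˡ (q ^ m)) ⟩
    q ^ m * q ^ m * q ^ m       ∎

  certificate : ℕ → ℕ → ℚ
  certificate n j = - (pentagonal (suc j) * q ^ (n ∸ j))
                    * (qp q (suc n) * qp q n * (iqp (n ∸ j) * iqp (suc (n ℕ.+ j))))

  certificate-form : ∀ {n j} → j < n →
    let a = q ^ suc (n ∸ suc j); x = q ^ suc j; P = qp q n in
    certificate n j
      ≡ - (pentagonal (suc j) * a)
        * (P * (1ℚ - a * x) * P * (iqp (n ∸ suc j) * inv (1ℚ - a) * iqp (n ℕ.+ suc j)))
  certificate-form {n} {j} j<n = begin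
    - (Z * q ^ (n ∸ j)) * (qp q (suc n) * P * (iqp (n ∸ j) * iqp (suc (n ℕ.+ j))))
      ≡⟨ cong₂ (λ u v → - (Z * q ^ u) * (qp q (suc n) * P * (iqp u * iqp v)))
               (ℕₚ.+-∸-assoc 1 j<n) (sym (ℕₚ.+-suc n j)) ⟩
    - (Z * q ^ suc (n ∸ suc j)) * (qp q (suc n) * P * (iqp (suc (n ∸ suc j)) * iqp (n ℕ.+ suc j)))
      ≡⟨ cong₂ (λ u v → - (Z * q ^ suc (n ∸ suc j)) * (u * P * (v * iqp (n ℕ.+ suc j))))
               (qp-suc-split j<n) (iqp-suc (n ∸ suc j)) ⟩
    _ ∎
    where
    Z = pentagonal (suc j)
    P = qp q n

  certificate-suc-form : ∀ {n j} → j < n →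
    let a = q ^ suc (n ∸ suc j); x = q ^ suc j; P = qp q n in
    certificate n (suc j)
      ≡ pentagonal (suc j) * (a * x * x * x)
        * (P * (1ℚ - a * x) * P * (iqp (n ∸ suc j) * (iqp (n ℕ.+ suc j) * inv (1ℚ - a * x * x))))
  certificate-suc-form {n} {j} j<n = begin
    - (pentagonal (suc (suc j)) * S) * (qp q (suc n) * P * (A * iqp (suc (n ℕ.+ suc j))))
      ≡⟨ cong₂ (λ u v → - (u * S) * v) (pentagonal-suc (suc j))
               (cong₂ (λ u v → u * P * (A * v)) (qp-suc-split j<n) (iqp-+-split j<n)) ⟩
    - (- (Z * (q ^ (3 ℕ.* suc j) * q)) * S) * rest
      ≡⟨ cong (λ u → - (- (Z * (u * q)) * S) * rest) (^-3* (suc j)) ⟩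
    - (- (Z * (x * x * x * q)) * S) * rest
      ≡⟨ cong (_* rest) (shift Z x q S) ⟩
    Z * (S * q * x * x * x) * rest ∎
    where
    Z = pentagonal (suc j)
    P = qp q n
    A = iqp (n ∸ suc j)
    S = q ^ (n ∸ suc j)
    x = q ^ suc j
    rest = P * (1ℚ - S * q * x) * P * (A * (iqp (n ℕ.+ suc j) * inv (1ℚ - S * q * x * x)))
    shift : ∀ Z x q S → - (- (Z * (x * x * x * q)) * S) ≡ Z * (S * q * x * x * x)
    shift = solve-∀ ℚ-ring

  pentagonal-step : ∀ {n j} → FactorsNonZero (suc n ℕ.+ suc n) → j < n →
                    term 0 (suc n) (suc j)
                      ≡ (1ℚ - q ^ suc n) * term 0 n (suc j) + (certificate n (suc j) - certificate n j)
  pentagonal-step {n} {j} nz j<n = begin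
    term 0 (suc n) (suc j)
      ≡⟨ term-suc-N 0 j<n ⟩
    term 0 n (suc j) * growth a x
      ≡⟨ pentagonal-core Z x a P A B ia ic (inv-inverseˡ a≢1) (inv-inverseˡ axx≢1) ⟩
    (1ℚ - a * x) * term 0 n (suc j)
      + (Z * (a * x * x * x) * (P * (1ℚ - a * x) * P * (A * (B * ic)))
         - - (Z * a) * (P * (1ℚ - a * x) * P * (A * ia * B)))
      ≡⟨ sym (cong₂ (λ u v → (1ℚ - u) * term 0 n (suc j) + v) (q^suc-split j<n)
                    (cong₂ _-_ (certificate-suc-form j<n) (certificate-form j<n))) ⟩
    (1ℚ - q ^ suc n) * term 0 n (suc j) + (certificate n (suc j) - certificate n j) ∎
    where
    Z = pentagonal (suc j)
    a = q ^ suc (n ∸ suc j)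
    x = q ^ suc j
    P = qp q n
    A = iqp (n ∸ suc j)
    B = iqp (n ℕ.+ suc j)
    ia = inv (1ℚ - a)
    ic = inv (1ℚ - a * x * x)
    a≢1 : 1ℚ - a ≢ 0ℚ
    a≢1 = 1-q^suc≢0 nz (ℕₚ.≤-trans (s≤s (ℕₚ.m∸n≤m n (suc j))) (ℕₚ.m≤m+n (suc n) (suc n)))
    axx≢1 : 1ℚ - a * x * x ≢ 0ℚ
    axx≢1 = subst (λ y → 1ℚ - y ≢ 0ℚ) (q^suc+-split j<n)
                  (1-q^suc≢0 nz (s≤s (ℕₚ.+-monoʳ-≤ n (ℕₚ.m≤n⇒m≤1+n j<n))))

  certificate-zero : ∀ {B} n → FactorsNonZero B → suc n ≤ B → certificate n 0 ≡ q ^ suc n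
  certificate-zero n nz n<B = begin
    - (pentagonal 1 * q ^ n) * (qp q (suc n) * qp q n * (iqp n * iqp (suc (n ℕ.+ 0))))
      ≡⟨ cong₂ (λ u v → - (u * q ^ n) * (qp q (suc n) * qp q n * (iqp n * iqp (suc v))))
               pentagonal-one (ℕₚ.+-identityʳ n) ⟩
    - (- q * q ^ n) * (qp q (suc n) * qp q n * (iqp n * iqp (suc n)))
      ≡⟨ regroup q (q ^ n) (qp q (suc n)) (qp q n) (iqp n) (iqp (suc n)) ⟩
    q ^ n * q * (iqp (suc n) * qp q (suc n)) * (iqp n * qp q n)
      ≡⟨ cong₂ (λ u v → q ^ n * q * u * v) (inv-inverseˡ (qp≢0 nz (suc n) n<B))
                                             (inv-inverseˡ (qp≢0 nz n (ℕₚ.<⇒≤ n<B))) ⟩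
    q ^ n * q * 1ℚ * 1ℚ
      ≡⟨ drop-units (q ^ n * q) ⟩
    q ^ suc n ∎
    where
    regroup : ∀ q y Q P iP iQ → - (- q * y) * (Q * P * (iP * iQ)) ≡ y * q * (iQ * Q) * (iP * P)
    regroup = solve-∀ ℚ-ring
    drop-units : ∀ y → y * 1ℚ * 1ℚ ≡ y
    drop-units = solve-∀ ℚ-ring

  -- The step identity fails at j = n, where n ∸ (n + 1) truncates to 0.
  certificate-last : ∀ n → FactorsNonZero (suc n ℕ.+ suc n) → term 0 (suc n) (suc n) ≡ - certificate n n
  certificate-last n nz = begin
    Z * (1ℚ + x) * 1ℚ * (Q * Q * (iqp (n ∸ n) * iqp (suc n ℕ.+ suc n)))
      ≡⟨ cong₂ (λ u v → Z * (1ℚ + x) * 1ℚ * (u * u * v)) (qp-suc n)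
               (cong₂ _*_ (cong iqp (ℕₚ.n∸n≡0 n)) top) ⟩
    Z * (1ℚ + x) * 1ℚ * (P * (1ℚ - x) * (P * (1ℚ - x)) * (1ℚ * (B * inv (1ℚ - x * x))))
      ≡⟨ core Z x P B (inv (1ℚ - x * x)) (inv-inverseˡ xx≢1) ⟩
    - (- (Z * 1ℚ) * (P * (1ℚ - x) * P * (1ℚ * B)))
      ≡⟨ sym (cong₂ (λ u v → - (- (Z * q ^ u) * (v * P * (iqp u * B)))) (ℕₚ.n∸n≡0 n) (qp-suc n)) ⟩
    - (- (Z * q ^ (n ∸ n)) * (Q * P * (iqp (n ∸ n) * B)))
      ≡⟨ cong (λ u → - (- (Z * q ^ (n ∸ n)) * (Q * P * (iqp (n ∸ n) * iqp u)))) (ℕₚ.+-suc n n) ⟩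
    - certificate n n ∎
    where
    Z = pentagonal (suc n)
    x = q ^ suc n
    P = qp q n
    Q = qp q (suc n)
    B = iqp (n ℕ.+ suc n)
    x² : q ^ (suc n ℕ.+ suc n) ≡ x * x
    x² = ^-distribˡ-+-* q (suc n) (suc n)
    top : iqp (suc n ℕ.+ suc n) ≡ B * inv (1ℚ - x * x)
    top = trans (iqp-suc (n ℕ.+ suc n)) (cong (λ y → B * inv (1ℚ - y)) x²)
    xx≢1 : 1ℚ - x * x ≢ 0ℚ
    xx≢1 = subst (λ y → 1ℚ - y ≢ 0ℚ) x² (nz _ (s≤s z≤n) ℕₚ.≤-refl)
    core : ∀ Z x P B ic → ic * (1ℚ - x * x) ≡ 1ℚ →
           Z * (1ℚ + x) * 1ℚ * (P * (1ℚ - x) * (P * (1ℚ - x)) * (1ℚ * (B * ic)))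
             ≡ - (- (Z * 1ℚ) * (P * (1ℚ - x) * P * (1ℚ * B)))
    core Z x P B ic hc = begin
      Z * (1ℚ + x) * 1ℚ * (P * (1ℚ - x) * (P * (1ℚ - x)) * (1ℚ * (B * ic)))
        ≡⟨ solve (Z ∷ x ∷ P ∷ B ∷ ic ∷ []) ℚ-ring ⟩
      Z * P * P * B * (1ℚ - x) * (ic * (1ℚ - x * x))
        ≡⟨ cong (Z * P * P * B * (1ℚ - x) *_) hc ⟩
      Z * P * P * B * (1ℚ - x) * 1ℚ
        ≡⟨ solve (Z ∷ x ∷ P ∷ B ∷ ic ∷ []) ℚ-ring ⟩
      - (- (Z * 1ℚ) * (P * (1ℚ - x) * P * (1ℚ * B))) ∎

  pentagonal-identity : ∀ n → FactorsNonZero (n ℕ.+ n) → Σterm 0 n ≡ qp q n - 1ℚ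
  pentagonal-identity zero _ = refl
  pentagonal-identity (suc n) nz = begin
    sum1 n (term 0 (suc n)) + term 0 (suc n) (suc n)
      ≡⟨ cong₂ _+_ (sum1-cong n step) (certificate-last n nz) ⟩
    sum1 n (λ r → c * term 0 n r + (Γ r - Γ (pred r))) + - Γ n
      ≡⟨ cong (_+ - Γ n) (trans (sum1-+ n (λ r → c * term 0 n r) (λ r → Γ r - Γ (pred r)))
                                (cong₂ _+_ (sum1-*ˡ n c (term 0 n)) (sum1-telescope n Γ))) ⟩
    c * Σterm 0 n + (Γ n - Γ 0) + - Γ n
      ≡⟨ cong₂ (λ u v → c * u + (Γ n - v) + - Γ n)
               (pentagonal-identity n (FactorsNonZero-mono (ℕₚ.+-mono-≤ n≤1+n n≤1+n) nz))
               (certificate-zero n nz (ℕₚ.m≤m+n (suc n) (suc n))) ⟩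
    c * (qp q n - 1ℚ) + (Γ n - q ^ suc n) + - Γ n
      ≡⟨ collapse (qp q n) (q ^ suc n) (Γ n) ⟩
    qp q n * (1ℚ - q ^ suc n) - 1ℚ
      ≡⟨ cong (_- 1ℚ) (sym (qp-suc n)) ⟩
    qp q (suc n) - 1ℚ ∎
    where
    c = 1ℚ - q ^ suc n
    Γ = certificate n
    n≤1+n = ℕₚ.n≤1+n n
    step : ∀ r → 1 ≤ r → r ≤ n → term 0 (suc n) r ≡ c * term 0 n r + (Γ r - Γ (pred r))
    step (suc j) _ j<n = pentagonal-step nz j<n
    collapse : ∀ P y G → (1ℚ - y) * (P - 1ℚ) + (G - y) + - G ≡ P * (1ℚ - y) - 1ℚ
    collapse = solve-∀ ℚ-ring

  chain≡Σterm : ∀ B → FactorsNonZero (B ℕ.+ B) →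
                ∀ k N → N ≤ B → chain q (λ n → qp q n - 1ℚ) k N ≡ Σterm k N
  chain≡Σterm B nz = chain-unique q (λ n → qp q n - 1ℚ) Σterm B
    (λ N N≤B → pentagonal-identity N (FactorsNonZero-mono (ℕₚ.+-mono-≤ N≤B N≤B) nz))
    (λ _ → refl)
    (λ k N N<B → Σterm-step k N (FactorsNonZero-mono (ℕₚ.+-mono-≤ N<B N<B) nz))

  scaled-summand≡term : ∀ k N r →
    qp q N * qp q N * ((((- 1ℚ) ^ r * q ^ (pent r ℕ.+ k ℕ.* r)) * (1ℚ + q ^ r))
                        ÷ ((qp q (N ∸ r) * qp q (N ℕ.+ r)) * (1ℚ - q ^ r) ^ (2 ℕ.* k)))
      ≡ term k N r
  scaled-summand≡term k N r = begin
    P * P * (s * q ^ (pent r ℕ.+ k ℕ.* r) * C * inv (A * B * Dᵏ))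
      ≡⟨ cong₂ (λ u v → P * P * (s * u * C * v)) (^-distribˡ-+-* q (pent r) (k ℕ.* r))
               (trans (inv-distrib-* (A * B) Dᵏ) (cong (_* inv Dᵏ) (inv-distrib-* A B))) ⟩
    P * P * (s * (q ^ pent r * q ^ (k ℕ.* r)) * C * (inv A * inv B * inv Dᵏ))
      ≡⟨ regroup P s (q ^ pent r) (q ^ (k ℕ.* r)) C (inv A) (inv B) (inv Dᵏ) ⟩
    s * q ^ pent r * C * (q ^ (k ℕ.* r) * inv Dᵏ) * (P * P * (inv A * inv B))
      ≡⟨ cong (λ u → s * q ^ pent r * C * (u * inv Dᵏ) * (P * P * (inv A * inv B)))
              (trans (cong (q ^_) (ℕₚ.*-comm k r)) (sym (^-*-assoc q r k))) ⟩
    s * q ^ pent r * C * ((q ^ r) ^ k * inv Dᵏ) * (P * P * (inv A * inv B))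
      ≡⟨ cong (λ u → s * q ^ pent r * C * u * (P * P * (inv A * inv B))) (ω-^ (q ^ r) k) ⟩
    term k N r ∎
    where
    P = qp q N
    A = qp q (N ∸ r)
    B = qp q (N ℕ.+ r)
    s = (- 1ℚ) ^ r
    C = 1ℚ + q ^ r
    Dᵏ = (1ℚ - q ^ r) ^ (2 ℕ.* k)
    regroup : ∀ P s p t C iA iB iD →
              P * P * (s * (p * t) * C * (iA * iB * iD)) ≡ s * p * C * (t * iD) * (P * P * (iA * iB))
    regroup = solve-∀ ℚ-ring

corollary5p4 : (N k : ℕ) → 1 ≤ N → 1 ≤ k → (q : ℚ)
    → (∀ (i : ℕ) → 1 ≤ i → i ≤ 2 ℕ.* N → 1ℚ - q ^ i ≢ 0ℚ)
    → chain q (λ n → qp q n) k N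
      ≡ chain q (λ n → 1ℚ) k N
        + (qp q N * qp q N)
          * sum1 N (λ r → (((- 1ℚ) ^ r * q ^ (pent r ℕ.+ k ℕ.* r)) * (1ℚ + q ^ r))
                           ÷ ((qp q (N ℕ.∸ r) * qp q (N ℕ.+ r)) * (1ℚ - q ^ r) ^ (2 ℕ.* k)))
corollary5p4 N k _ _ q nz = begin
  chain q (qp q) k N
    ≡⟨ chain-+ q (λ n → split (qp q n)) k N ⟩
  chain q (λ _ → 1ℚ) k N + chain q (λ n → qp q n - 1ℚ) k N
    ≡⟨ cong (chain q (λ _ → 1ℚ) k N +_) (chain≡Σterm q N nz′ k N ℕₚ.≤-refl) ⟩
  chain q (λ _ → 1ℚ) k N + Σterm q k N
    ≡⟨ cong (chain q (λ _ → 1ℚ) k N +_)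
            (trans (sum1-cong N (λ r _ _ → sym (scaled-summand≡term q k N r)))
                   (sum1-*ˡ N (qp q N * qp q N) _)) ⟩
  _ ∎
  where
  split : ∀ p → p ≡ 1ℚ + (p - 1ℚ)
  split = solve-∀ ℚ-ring
  nz′ : FactorsNonZero q (N ℕ.+ N)
  nz′ i 1≤i i≤2N = nz i 1≤i (subst (i ≤_) (cong (N ℕ.+_) (sym (ℕₚ.+-identityʳ N))) i≤2N)
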